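{- Let \(\mathcal V\) be a universe. The following are equivalent: (i) there exists a positive locally small \(\delta_{\mathcal V}\)-complete poset with \(\neg\neg\)-stable equality; (ii) there exists a positive locally small \(\delta_{\mathcal V}\)-complete poset with decidable equality; (iii) excluded middle in \(\mathcal V\) holds.
   Context: Setting: univalent foundations (intensional Martin-Löf type theory with universes, function extensionality, propositional extensionality, propositional truncation); excluded middle and propositional resizing are not assumed. A proposition is a type with at most one element. Excluded middle in \(\mathcal V\): every proposition \(P:\mathcal V\) satisfies \(P\) or \(\neg P\). A type has decidable equality if for all \(a,b\), \(a=b\) or \(a\neq b\); it has \(\neg\neg\)-stable equality if \(\neg\neg(a=b)\to a=b\) for all \(a,b\). A poset is a type \(X\) with a proposition-valued reflexive, transitive, antisymmetric relation \(\sqsubseteq\). For \(x\sqsubseteq y\) and a proposition \(P:\mathcal V\), \(\delta_{x,y,P}:\mathbf 1+P\to X\) sends \(\mathrm{inl}(\star)\mapsto x\), \(\mathrm{inr}(p)\mapsto y\); the poset is \(\delta_{\mathcal V}\)-complete if all such families have suprema \(\bigvee\delta_{x,y,P}\). It is locally small if there is \(\sqsubseteq_{\mathcal V}:X\to X\to\mathcal V\) with \((x\sqsubseteq y)\simeq(x\sqsubseteq_{\mathcal V}y)\). In a \(\delta_{\mathcal V}\)-complete poset, \(x\) is strictly below \(y\) if \(x\sqsubseteq y\) and for every \(z\) with \(y\sqsubseteq z\) and every proposition \(P:\mathcal V\), \(z=\bigvee\delta_{x,z,P}\) implies \(P\). The poset is positive if it comes with designated elements \(x,y\) with \(x\) strictly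 below \(y\). -}

module Defs where

open import Level using (Level; _⊔_; suc; 0ℓ)
open import Data.Unit using (⊤; tt)
open import Data.Sum using (_⊎_; inj₁; inj₂)
open import Data.Product using (Σ; Σ-syntax; _×_; _,_; proj₁; proj₂)
open import Data.Empty using (⊥)
open import Relation.Nullary using (¬_; Dec)
open import Relation.Binary.PropositionalEquality using (_≡_)
open import Function.Bundles using (_↔_)

isProp : ∀ {ℓ} → Set ℓ → Set ℓ
isProp X = (a b : X) → a ≡ b

PropExt : (ℓ : Level) → Set (suc ℓ)
PropExt ℓ = (P Q : Set ℓ) → isProp P → isProp Q → (P → Q) → (Q → P) → P ≡ Q

EM : (v : Level) → Set (suc v)
EM v = (P : Set v) → isProp P → P ⊎ ¬ P

record Poset (u t : Level) : Set (suc (u ⊔ t)) where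
  field
    Carrier       : Set u
    _⊑_           : Carrier → Carrier → Set t
    ⊑-prop        : (x y : Carrier) → isProp (x ⊑ y)
    ⊑-refl        : (x : Carrier) → x ⊑ x
    ⊑-trans       : (x y z : Carrier) → x ⊑ y → y ⊑ z → x ⊑ z
    ⊑-antisym     : (x y : Carrier) → x ⊑ y → y ⊑ x → x ≡ y

module _ {u t : Level} (X : Poset u t) where
  open Poset X

  IsSup : ∀ {i} {I : Set i} → (I → Carrier) → Carrier → Set (u ⊔ t ⊔ i)
  IsSup {I = I} α s = ((k : I) → α k ⊑ s)
                    × ((w : Carrier) → ((k : I) → α k ⊑ w) → s ⊑ w)

  δ : ∀ {v} (x y : Carrier) (P : Set v) → ⊤ ⊎ P → Carrier
  δ x y P (inj₁ _) = x
  δ x y P (inj₂ _) = y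

  δ-complete : (v : Level) → Set (u ⊔ t ⊔ suc v)
  δ-complete v = (x y : Carrier) → x ⊑ y → (P : Set v) → isProp P
               → Σ[ s ∈ Carrier ] IsSup (δ x y P) s

  locally-small : (v : Level) → Set (u ⊔ t ⊔ suc v)
  locally-small v = Σ[ _⊑ᵥ_ ∈ (Carrier → Carrier → Set v) ]
                    ((x y : Carrier) → (x ⊑ y) ↔ (x ⊑ᵥ y))

  has-decidable-equality : Set u
  has-decidable-equality = (a b : Carrier) → Dec (a ≡ b)

  has-¬¬-stable-equality : Set u
  has-¬¬-stable-equality = (a b : Carrier) → ¬ ¬ (a ≡ b) → a ≡ b

  module _ {v : Level} (c : δ-complete v) where
    ⋁δ : (x y : Carrier) → x ⊑ y → (P : Set v) → isProp P → Carrier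
    ⋁δ x y l P i = proj₁ (c x y l P i)

    strictly-below : Carrier → Carrier → Set (u ⊔ t ⊔ suc v)
    strictly-below x y =
      Σ[ l ∈ x ⊑ y ]
        ((z : Carrier) (m : y ⊑ z) (P : Set v) (i : isProp P)
          → z ≡ ⋁δ x z (⊑-trans x y z l m) P i → P)

    positive : Set (u ⊔ t ⊔ suc v)
    positive = Σ[ x ∈ Carrier ] Σ[ y ∈ Carrier ] strictly-below x y

record PosLSδPoset (v u t : Level) : Set (suc (v ⊔ u ⊔ t)) where
  field
    poset    : Poset u t
    complete : δ-complete poset v
    locsmall : locally-small poset v
    pos      : positive poset complete

{-# OPTIONS --safe #-}
-- If x is strictly below y, a proposition P holds exactly when ⋁δ x y P = y; so ¬¬-stable
-- equality of the poset makes every proposition ¬¬-stable, which yields excluded middle.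
-- Conversely, under excluded middle every poset is δ-complete (the supremum is y or x
-- according as P holds or fails), and the two-element poset false < true is then positive
-- with decidable equality.
module Submission where

open import Defs
open import Level using (Level; 0ℓ; Lift; lift; lower)
open import Data.Bool.Base using (Bool; true; false; _≤_; f≤t)
open import Data.Bool.Properties using (_≟_; ≤-refl; ≤-trans; ≤-antisym; ≤-irrelevant)
open import Data.Product using (Σ-syntax; _×_; _,_; proj₁; proj₂)
open import Data.Sum using (_⊎_; inj₁; inj₂)
open import Data.Empty using (⊥-elim)
open import Function.Base using (_∘_)
open import Function.Bundles using (_⇔_; mk⇔; mk↔ₛ′)
open import Axiom.Extensionality.Propositional using (Extensionality)
open import Relation.Nullary using (¬_; Stable)
open import Relation.Nullary.Decidable using (decidable-stable; map′)
open import Relation.Binary.PropositionalEquality using (_≡_; _≢_; refl; sym; trans; cong)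

isProp-⊎-¬ : ∀ {v} {P : Set v} → Extensionality v 0ℓ → isProp P → isProp (P ⊎ ¬ P)
isProp-⊎-¬ fe i (inj₁ p) (inj₁ q) = cong inj₁ (i p q)
isProp-⊎-¬ fe i (inj₁ p) (inj₂ np) = ⊥-elim (np p)
isProp-⊎-¬ fe i (inj₂ np) (inj₁ p) = ⊥-elim (np p)
isProp-⊎-¬ fe i (inj₂ np) (inj₂ nq) = cong inj₂ (fe λ p → ⊥-elim (np p))

-- P ⊎ ¬ P is irrefutable, and a proposition by function extensionality.
stable-props⇒EM : ∀ {v} → Extensionality v 0ℓ
                → ((P : Set v) → isProp P → Stable P) → EM v
stable-props⇒EM fe stable P i =
  stable (P ⊎ ¬ P) (isProp-⊎-¬ fe i) (λ k → k (inj₂ (k ∘ inj₁)))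

decidable⇒¬¬-stable-equality : ∀ {u t} (X : Poset u t)
                             → has-decidable-equality X → has-¬¬-stable-equality X
decidable⇒¬¬-stable-equality X d a b = decidable-stable (d a b)

module _ {u t : Level} (X : Poset u t) where
  open Poset X

  IsSup-unique : ∀ {i} {I : Set i} {α : I → Carrier} {s s′ : Carrier}
               → IsSup X α s → IsSup X α s′ → s ≡ s′
  IsSup-unique (ub , least) (ub′ , least′) = ⊑-antisym _ _ (least _ ub′) (least′ _ ub)

  δ-sup-top : ∀ {v} {x y : Carrier} {P : Set v} → x ⊑ y → P → IsSup X (δ X x y P) y
  δ-sup-top {y = y} l p = (λ { (inj₁ _) → l ; (inj₂ _) → ⊑-refl y }) , λ w ub → ub (inj₂ p)

  δ-sup-bottom : ∀ {v} {x y : Carrier} {P : Set v} → ¬ P → IsSup X (δ X x y P) x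
  δ-sup-bottom {x = x} np = (λ { (inj₁ _) → ⊑-refl x ; (inj₂ p) → ⊥-elim (np p) })
                          , λ w ub → ub (inj₁ _)

  EM⇒δ-complete : ∀ {v} → EM v → δ-complete X v
  EM⇒δ-complete em x y l P i with em P i
  ... | inj₁ p  = y , δ-sup-top l p
  ... | inj₂ np = x , δ-sup-bottom np

  module _ {v : Level} (c : δ-complete X v) where

    ⋁δ-≡-top : ∀ {x y} (l : x ⊑ y) (P : Set v) (i : isProp P) → P → ⋁δ X c x y l P i ≡ y
    ⋁δ-≡-top {x} {y} l P i p = IsSup-unique (proj₂ (c x y l P i)) (δ-sup-top l p)

    ⋁δ-≡-bottom : ∀ {x y} (l : x ⊑ y) (P : Set v) (i : isProp P) → ¬ P → ⋁δ X c x y l P i ≡ x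
    ⋁δ-≡-bottom {x} {y} l P i np = IsSup-unique (proj₂ (c x y l P i)) (δ-sup-bottom np)

    strictly-below⇒stable-props : ∀ {x y} → strictly-below X c x y → has-¬¬-stable-equality X
                                → (P : Set v) → isProp P → Stable P
    strictly-below⇒stable-props {x} {y} (l , strict) stable P i ¬¬p =
      strict y (⊑-refl y) P i (sym (stable _ _ λ s≢y → ¬¬p (s≢y ∘ ⋁δ-≡-top l′ P i)))
      where l′ = ⊑-trans x y y l (⊑-refl y)

    EM⇒strictly-below : EM v → ∀ {x y} → x ⊑ y → (∀ z → y ⊑ z → x ≢ z) → strictly-below X c x y
    EM⇒strictly-below em {x} {y} l x≢above = l , above
      where
      above : ∀ z (m : y ⊑ z) (P : Set v) (i : isProp P)
            → z ≡ ⋁δ X c x z (⊑-trans x y z l m) P i → P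
      above z m P i e with em P i
      ... | inj₁ p  = p
      ... | inj₂ np = ⊥-elim (x≢above z m (sym (trans e (⋁δ-≡-bottom _ P i np))))

¬¬-stable-equality⇒EM : ∀ {v u t} → Extensionality v 0ℓ → (X : PosLSδPoset v u t)
                      → has-¬¬-stable-equality (PosLSδPoset.poset X) → EM v
¬¬-stable-equality⇒EM fe X stable =
  stable-props⇒EM fe (strictly-below⇒stable-props poset complete (proj₂ (proj₂ pos)) stable)
  where open PosLSδPoset X

module Booleans (u t : Level) where

  𝟚 : Poset u t
  𝟚 = record
    { Carrier   = Lift u Bool
    ; _⊑_       = λ a b → Lift t (lower a ≤ lower b)
    ; ⊑-prop    = λ { _ _ (lift p) (lift q) → cong lift (≤-irrelevant p q) }
    ; ⊑-refl    = λ _ → lift ≤-refl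
    ; ⊑-trans   = λ { _ _ _ (lift p) (lift q) → lift (≤-trans p q) }
    ; ⊑-antisym = λ { _ _ (lift p) (lift q) → cong lift (≤-antisym p q) }
    }

  𝟚-decidable-equality : has-decidable-equality 𝟚
  𝟚-decidable-equality (lift a) (lift b) = map′ (cong lift) (cong lower) (a ≟ b)

  𝟚-locally-small : ∀ v → locally-small 𝟚 v
  𝟚-locally-small v = (λ a b → Lift v (lower a ≤ lower b))
                    , λ a b → mk↔ₛ′ (lift ∘ lower) (lift ∘ lower) (λ _ → refl) (λ _ → refl)

  false≢above-true : ∀ z → Poset._⊑_ 𝟚 (lift true) z → lift false ≢ z
  false≢above-true (lift true) _ ()

  EM⇒𝟚-PosLSδPoset : ∀ {v} → EM v → PosLSδPoset v u t
  EM⇒𝟚-PosLSδPoset {v} em = record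
    { poset    = 𝟚
    ; complete = complete
    ; locsmall = 𝟚-locally-small v
    ; pos      = lift false , lift true
               , EM⇒strictly-below 𝟚 complete em (lift f≤t) false≢above-true
    }
    where complete = EM⇒δ-complete 𝟚 em

theorem3p26 : (fe : ∀ {a b} → Extensionality a b) → (pe : ∀ {ℓ} → PropExt ℓ)
    → (v u t : Level)
    → ((Σ[ X ∈ PosLSδPoset v u t ] has-¬¬-stable-equality (PosLSδPoset.poset X)) ⇔ EM v)
    × ((Σ[ X ∈ PosLSδPoset v u t ] has-decidable-equality (PosLSδPoset.poset X)) ⇔ EM v)
theorem3p26 fe _ v u t =
    mk⇔ (λ { (X , stable) → ¬¬-stable-equality⇒EM fe X stable })
        (λ em → EM⇒𝟚-PosLSδPoset em , decidable⇒¬¬-stable-equality 𝟚 𝟚-decidable-equality)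
  , mk⇔ (λ { (X , dec) → ¬¬-stable-equality⇒EM fe X
                           (decidable⇒¬¬-stable-equality (PosLSδPoset.poset X) dec) })
        (λ em → EM⇒𝟚-PosLSδPoset em , 𝟚-decidable-equality)
  where open Booleans u t
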